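{- Let $(\mathsf{e},\gamma)$ be an actual event with $\mathbb{P}(\mathsf{e},\gamma)=_{\mathbb{R}}0$, and let $\mathsf{e}'$ be a potential event with $\mathsf{e}'\le\mathsf{e}$. Then $(\mathsf{e}',\lambda n.\gamma(6n))$ is an actual event.
   Context: A potential event is a sequence $\mathsf{e}:\mathbb{N}^{+}\to\{0,1\}$; $\mathsf{e}'\le\mathsf{e}$ iff $\mathsf{e}'(n)\le\mathsf{e}(n)$ for all $n$. Define $\Phi(\mathsf{e})(n)=\frac{\sum_{i=1}^{n}\mathsf{e}(i)}{n}$. An actual event is a pair $(\mathsf{e},\gamma)$ with $\gamma:\mathbb{N}^{+}\to\mathbb{N}^{+}$ strictly increasing and $|\Phi(\mathsf{e})(\gamma(n)+i)-\Phi(\mathsf{e})(\gamma(n)+j)|\le\frac1n$ for all $n\in\mathbb{N}^{+}$, $i,j\in\mathbb{N}$; $\mathbb{P}(\mathsf{e},\gamma):=\Phi(\mathsf{e})\circ\gamma$. Bishop reals are sequences $x:\mathbb{N}^{+}\to\mathbb{Q}$ with $|x(n)-x(m)|\le\frac1n+\frac1m$; $x=_{\mathbb{R}}0$ iff $|x(n)|\le\frac2n$ for all $n\in\mathbb{N}^{+}$. -}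

module Defs where

open import Data.Nat as ℕ using (ℕ; zero; suc; NonZero)
open import Data.Integer using (+_)
open import Data.Rational using (ℚ; _/_; ∣_∣; _-_; _≤_; 1ℚ)
open import Data.Product using (_×_)

-- Sequences indexed by ℕ⁺ are modelled as functions ℕ → X; the value at 0
-- is irrelevant and every quantifier below ranges over positive indices only.

PotentialEvent : (ℕ → ℕ) → Set
PotentialEvent e = ∀ n → NonZero n → e n ℕ.≤ 1

_≼_ : (ℕ → ℕ) → (ℕ → ℕ) → Set
e' ≼ e = ∀ n → NonZero n → e' n ℕ.≤ e n

partialSum : (ℕ → ℕ) → ℕ → ℕ
partialSum e zero = zero
partialSum e (suc n) = partialSum e n ℕ.+ e (suc n)

Φ : (ℕ → ℕ) → (n : ℕ) → .{{NonZero n}} → ℚ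
Φ e n = (+ partialSum e n) / n

StrictlyIncreasing : (ℕ → ℕ) → Set
StrictlyIncreasing γ = ∀ m n → NonZero m → m ℕ.< n → γ m ℕ.< γ n

PositiveValued : (ℕ → ℕ) → Set
PositiveValued γ = ∀ n → NonZero n → NonZero (γ n)

inv : (n : ℕ) → .{{NonZero n}} → ℚ
inv n = (+ 1) / n

record ActualEvent (e γ : ℕ → ℕ) : Set where
  field
    potential : PotentialEvent e
    γ-pos     : PositiveValued γ
    γ-incr    : StrictlyIncreasing γ
    cauchy    : ∀ (n : ℕ) .{{_ : NonZero n}} (i j : ℕ)
                → .{{_ : NonZero (γ n ℕ.+ i)}} → .{{_ : NonZero (γ n ℕ.+ j)}}
                → ∣ Φ e (γ n ℕ.+ i) - Φ e (γ n ℕ.+ j) ∣ ≤ inv n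

-- ℙ(e,γ) =_ℝ 0, i.e. |Φ(e)(γ(n))| ≤ 2/n for all n ∈ ℕ⁺
ProbZero : (e γ : ℕ → ℕ) → Set
ProbZero e γ = ∀ (n : ℕ) .{{_ : NonZero n}} → .{{_ : NonZero (γ n)}}
               → ∣ Φ e (γ n) ∣ ≤ (+ 2) / n

-- Let N = γ(6n). Since ℙ(e,γ) = 0, Φ(e)(N) ≤ 2/(6n), and the Cauchy condition at level 6n
-- moves Φ(e) by at most 1/(6n) after N, so Φ(e) ≤ 3/(6n) = 1/(2n) from N on. As e' ≤ e,
-- the same bound holds for the nonnegative Φ(e'), and two nonnegative numbers below 1/(2n)
-- differ by at most 1/n.
module Submission where

open import Data.Nat as ℕ using (ℕ; zero; suc; NonZero; _*_)
import Data.Nat.Properties as ℕ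
open import Data.Integer as ℤ using (+_; +≤+)
import Data.Integer.Properties as ℤ
open import Data.Integer.Tactic.RingSolver using (solve-∀)
open import Data.Rational using (_+_; _-_; -_; ∣_∣; _≤_; 0ℚ; _/_; toℚᵘ)
open import Data.Rational.Properties
import Data.Rational.Unnormalised as ℚᵘ
import Data.Rational.Unnormalised.Properties as ℚᵘ
open import Relation.Binary.PropositionalEquality

open import Defs

toℚᵘ-/ : ∀ i d .{{_ : NonZero d}} → toℚᵘ (i / d) ℚᵘ.≃ i ℚᵘ./ d
toℚᵘ-/ i (suc d) = toℚᵘ-fromℚᵘ (ℚᵘ.mkℚᵘ i d)

/-≤-cross : ∀ a b d d' .{{_ : NonZero d}} .{{_ : NonZero d'}} →
            a * d' ℕ.≤ b * d → + a / d ≤ + b / d'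
/-≤-cross a b d@(suc _) d'@(suc _) ad'≤bd = toℚᵘ-cancel-≤ (begin
  toℚᵘ (+ a / d)   ≃⟨ toℚᵘ-/ (+ a) d ⟩
  + a ℚᵘ./ d       ≤⟨ ℚᵘ.*≤* (subst₂ ℤ._≤_ (ℤ.pos-* a d') (ℤ.pos-* b d) (+≤+ ad'≤bd)) ⟩
  + b ℚᵘ./ d'      ≃⟨ toℚᵘ-/ (+ b) d' ⟨
  toℚᵘ (+ b / d')  ∎)
  where open ℚᵘ.≤-Reasoning

/-+-/ : ∀ a b d .{{_ : NonZero d}} → + a / d + + b / d ≡ + (a ℕ.+ b) / d
/-+-/ a b d@(suc _) = toℚᵘ-injective (begin-equality
  toℚᵘ (+ a / d + + b / d)            ≃⟨ toℚᵘ-homo-+ (+ a / d) (+ b / d) ⟩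
  toℚᵘ (+ a / d) ℚᵘ.+ toℚᵘ (+ b / d)  ≃⟨ ℚᵘ.+-cong (toℚᵘ-/ (+ a) d) (toℚᵘ-/ (+ b) d) ⟩
  + a ℚᵘ./ d ℚᵘ.+ + b ℚᵘ./ d          ≃⟨ ℚᵘ.*≡* numerators ⟩
  + (a ℕ.+ b) ℚᵘ./ d                  ≃⟨ toℚᵘ-/ (+ (a ℕ.+ b)) d ⟨
  toℚᵘ (+ (a ℕ.+ b) / d)              ∎)
  where
  open ℚᵘ.≤-Reasoning
  distrib : ∀ x y z → (x ℤ.* z ℤ.+ y ℤ.* z) ℤ.* z ≡ (x ℤ.+ y) ℤ.* (z ℤ.* z)
  distrib = solve-∀
  numerators : (+ a ℤ.* + d ℤ.+ + b ℤ.* + d) ℤ.* + d ≡ + (a ℕ.+ b) ℤ.* + (d * d)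
  numerators = trans (distrib (+ a) (+ b) (+ d)) (sym (cong₂ ℤ._*_ (ℤ.pos-+ a b) (ℤ.pos-* d d)))

0≤/ : ∀ a d .{{_ : NonZero d}} → 0ℚ ≤ + a / d
0≤/ a d = nonNegative⁻¹ (+ a / d) {{normalize-nonNeg a d}}

∣p∣≤∣p-q∣+∣q∣ : ∀ p q → ∣ p ∣ ≤ ∣ p - q ∣ + ∣ q ∣
∣p∣≤∣p-q∣+∣q∣ p q = subst (λ r → ∣ r ∣ ≤ ∣ p - q ∣ + ∣ q ∣) p-q+q≡p (∣p+q∣≤∣p∣+∣q∣ (p - q) q)
  where
  p-q+q≡p : p - q + q ≡ p
  p-q+q≡p = trans (+-assoc p (- q) q) (trans (cong (_+_ p) (+-inverseˡ q)) (+-identityʳ p))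

∣p-q∣≤p+q : ∀ {p q} → 0ℚ ≤ p → 0ℚ ≤ q → ∣ p - q ∣ ≤ p + q
∣p-q∣≤p+q {p} {q} 0≤p 0≤q =
  subst (∣ p - q ∣ ≤_) (cong₂ _+_ (0≤p⇒∣p∣≡p 0≤p) (0≤p⇒∣p∣≡p 0≤q)) (∣p-q∣≤∣p∣+∣q∣ p q)

Φ-nonNeg : ∀ e n .{{_ : NonZero n}} → 0ℚ ≤ Φ e n
Φ-nonNeg e n = 0≤/ (partialSum e n) n

Φ-cong : ∀ e {m n} .{{_ : NonZero m}} .{{_ : NonZero n}} → m ≡ n → Φ e m ≡ Φ e n
Φ-cong e refl = refl

partialSum-mono : ∀ {e' e} → e' ≼ e → ∀ n → partialSum e' n ℕ.≤ partialSum e n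
partialSum-mono e'≼e zero    = ℕ.z≤n
partialSum-mono e'≼e (suc n) = ℕ.+-mono-≤ (partialSum-mono e'≼e n) (e'≼e (suc n) _)

Φ-mono : ∀ {e' e} → e' ≼ e → ∀ n .{{_ : NonZero n}} → Φ e' n ≤ Φ e n
Φ-mono {e'} {e} e'≼e n =
  /-≤-cross (partialSum e' n) (partialSum e n) n n (ℕ.*-monoˡ-≤ n (partialSum-mono e'≼e n))

module _ {e γ : ℕ → ℕ} (E : ActualEvent e γ) (ℙ≡0 : ProbZero e γ) where
  open ActualEvent E

  Φ-tail-bound : ∀ m {{_ : NonZero m}} k .{{_ : NonZero (γ m ℕ.+ k)}} →
                 Φ e (γ m ℕ.+ k) ≤ + 3 / m
  Φ-tail-bound m {{m≢0}} k = begin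
    Φ e (γ m ℕ.+ k)                                  ≡⟨ 0≤p⇒∣p∣≡p (Φ-nonNeg e _) ⟨
    ∣ Φ e (γ m ℕ.+ k) ∣                              ≤⟨ ∣p∣≤∣p-q∣+∣q∣ _ _ ⟩
    ∣ Φ e (γ m ℕ.+ k) - Φ e (γ m ℕ.+ 0) ∣ + ∣ Φ e (γ m ℕ.+ 0) ∣
      ≤⟨ +-mono-≤ (cauchy m k 0) (≤-reflexive (cong ∣_∣ (Φ-cong e (ℕ.+-identityʳ (γ m))))) ⟩
    + 1 / m + ∣ Φ e (γ m) ∣                          ≤⟨ +-monoʳ-≤ (+ 1 / m) (ℙ≡0 m) ⟩
    + 1 / m + + 2 / m                                ≡⟨ /-+-/ 1 2 m ⟩
    + 3 / m                                          ∎
    where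
    open ≤-Reasoning
    instance
      γm≢0 : NonZero (γ m)
      γm≢0 = γ-pos m m≢0
      γm+0≢0 : NonZero (γ m ℕ.+ 0)
      γm+0≢0 = subst NonZero (sym (ℕ.+-identityʳ (γ m))) γm≢0

  subevent-oscillation : ∀ {e'} → e' ≼ e → ∀ m {{_ : NonZero m}} i j
                         .{{_ : NonZero (γ m ℕ.+ i)}} .{{_ : NonZero (γ m ℕ.+ j)}} →
                         ∣ Φ e' (γ m ℕ.+ i) - Φ e' (γ m ℕ.+ j) ∣ ≤ + 6 / m
  subevent-oscillation {e'} e'≼e m i j = begin
    ∣ Φ e' (γ m ℕ.+ i) - Φ e' (γ m ℕ.+ j) ∣  ≤⟨ ∣p-q∣≤p+q (Φ-nonNeg e' _) (Φ-nonNeg e' _) ⟩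
    Φ e' (γ m ℕ.+ i) + Φ e' (γ m ℕ.+ j)      ≤⟨ +-mono-≤ (Φ-mono e'≼e _) (Φ-mono e'≼e _) ⟩
    Φ e (γ m ℕ.+ i) + Φ e (γ m ℕ.+ j)        ≤⟨ +-mono-≤ (Φ-tail-bound m i) (Φ-tail-bound m j) ⟩
    + 3 / m + + 3 / m                        ≡⟨ /-+-/ 3 3 m ⟩
    + 6 / m                                  ∎
    where open ≤-Reasoning

mainTheorem8 : (e γ e' : ℕ → ℕ) → ActualEvent e γ → ProbZero e γ
               → PotentialEvent e' → e' ≼ e
               → ActualEvent e' (λ n → γ (6 * n))
mainTheorem8 e γ e' E ℙ≡0 e'-potential e'≼e = record
  { potential = e'-potential
  ; γ-pos     = λ n n≢0 → γ-pos (6 * n) (6n≢0 n≢0)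
  ; γ-incr    = λ m n m≢0 m<n → γ-incr (6 * m) (6 * n) (6n≢0 m≢0) (ℕ.*-monoʳ-< 6 m<n)
  ; cauchy    = λ n i j → ≤-trans (subevent-oscillation E ℙ≡0 e'≼e (6 * n) {{ℕ.m*n≢0 6 n}} i j)
                                  (/-≤-cross 6 1 (6 * n) n {{ℕ.m*n≢0 6 n}}
                                             (ℕ.≤-reflexive (sym (ℕ.*-identityˡ (6 * n)))))
  }
  where
  open ActualEvent E
  6n≢0 : ∀ {n} → NonZero n → NonZero (6 * n)
  6n≢0 {n} n≢0 = ℕ.m*n≢0 6 n {{_}} {{n≢0}}
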